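{- Let $r\geq 1$, let $m_1,\ldots,m_r\geq 3$ be integers, let $C_{m}$ denote the cycle on $m$ vertices, and let $k\geq 1$ be an integer. Then: (i) $2\leq {\rm la}_k(C_{m_1}\Box C_{m_2}\Box \cdots \Box C_{m_r})\leq 3r$; (ii) $1+\sum_{i=2}^r m_im_{i+1}\cdots m_r\leq {\rm la}_k(C_{m_1}\circ C_{m_2}\circ \cdots \circ C_{m_r})\leq 3\left(\sum_{i=2}^r m_im_{i+1}\cdots m_r+1\right)$; (iii) $2^{r-1}\leq {\rm la}_k(C_{m_1}\times C_{m_2}\times \cdots \times C_{m_r})\leq 3\cdot 6^{r-1}$; (iv) $\frac{1}{2}(3^{r}-1)\leq {\rm la}_k(C_{m_1}\boxtimes C_{m_2}\boxtimes \cdots \boxtimes C_{m_r})\leq 3(r+6^{r-1})$.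
   Context: A linear $k$-forest is a forest each of whose components is a path of length (number of edges) at most $k$. The linear $k$-arboricity ${\rm la}_k(G)$ is the least number of linear $k$-forests (subgraphs of $G$) whose edge sets partition $E(G)$. All products have vertex set $V(G)\times V(H)$. Cartesian $G\Box H$: $(u,v)\sim(u',v')$ iff ($u=u'$, $vv'\in E(H)$) or ($v=v'$, $uu'\in E(G)$). Lexicographic $G\circ H$: iff $uu'\in E(G)$, or ($u=u'$, $vv'\in E(H)$). Direct $G\times H$: iff $uu'\in E(G)$ and $vv'\in E(H)$. Strong $G\boxtimes H$: iff adjacent in $G\Box H$ or in $G\times H$. Iterated products are taken left to right, e.g. $C_{m_1}\circ C_{m_2}\circ C_{m_3}=(C_{m_1}\circ C_{m_2})\circ C_{m_3}$. -}

module Defs where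

open import Level using (0ℓ)
open import Data.Nat using (ℕ; zero; suc; _+_; _*_; _≤_)
open import Data.Fin using (Fin; toℕ)
open import Data.List using (List; []; _∷_; length; concat; foldl)
open import Data.Nat.ListAction using (product)
open import Data.List.Relation.Unary.All using (All)
open import Data.List.Relation.Unary.Any using (Any)
open import Data.List.Relation.Unary.Unique.Propositional using (Unique)
open import Data.Product using (Σ; _×_)
open import Data.Sum using (_⊎_)
open import Relation.Binary.PropositionalEquality using (_≡_)

-- A graph: a vertex type and an adjacency relation (all graphs built below
-- are finite, simple, and have symmetric irreflexive adjacency).
record Graph : Set₁ where
  field
    V   : Set
    Adj : V → V → Set
open Graph public

CycSucc : {m : ℕ} → Fin m → Fin m → Set
CycSucc {m} i j = (suc (toℕ i) ≡ toℕ j) ⊎ ((suc (toℕ i) ≡ m) × (toℕ j ≡ 0))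

C : ℕ → Graph
C m = record { V = Fin m ; Adj = λ i j → CycSucc i j ⊎ CycSucc j i }

_□_ : Graph → Graph → Graph
G □ H = record
  { V   = V G × V H
  ; Adj = λ { (u , v) (u' , v') → ((u ≡ u') × Adj H v v') ⊎ ((v ≡ v') × Adj G u u') } }
  where open Data.Product using (_,_)

_∘ₗ_ : Graph → Graph → Graph
G ∘ₗ H = record
  { V   = V G × V H
  ; Adj = λ { (u , v) (u' , v') → Adj G u u' ⊎ ((u ≡ u') × Adj H v v') } }
  where open Data.Product using (_,_)

_×ᵍ_ : Graph → Graph → Graph
G ×ᵍ H = record
  { V   = V G × V H
  ; Adj = λ { (u , v) (u' , v') → Adj G u u' × Adj H v v' } }
  where open Data.Product using (_,_)

_⊠_ : Graph → Graph → Graph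
G ⊠ H = record
  { V   = V G × V H
  ; Adj = λ x y → Adj (G □ H) x y ⊎ Adj (G ×ᵍ H) x y }

iterC : (Graph → Graph → Graph) → ℕ → List ℕ → Graph
iterC op m₁ ms = foldl (λ G m → op G (C m)) (C m₁) ms

data Step {A : Set} (u v : A) : List A → Set where
  here  : ∀ {xs} → Step u v (u ∷ v ∷ xs)
  there : ∀ {x xs} → Step u v xs → Step u v (x ∷ xs)

-- The spanning subgraph with edge relation E is a linear k-forest:
-- its edges are exactly the edges of a family of vertex-disjoint paths
-- (lists of distinct vertices), each of length (number of edges) ≤ k,
-- i.e. each path has at most k+1 vertices.  The components of the
-- subgraph are then exactly these paths (and isolated vertices).
LinearForest : {A : Set} → ℕ → (A → A → Set) → Set
LinearForest {A} k E =
  Σ (List (List A)) λ ps →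
      All (λ p → length p ≤ suc k) ps
    × Unique (concat ps)
    × (∀ u v → Any (Step u v) ps → E u v)
    × (∀ u v → E u v → Any (Step u v) ps ⊎ Any (Step v u) ps)

-- A partition of E(G) into t linear k-forests: an edge colouring with
-- colours Fin t (well defined on edges: f u v = f v u) such that every
-- colour class is a linear k-forest.
LinDecomp : ℕ → Graph → ℕ → Set
LinDecomp k G t =
  Σ (V G → V G → Fin t) λ f →
      (∀ u v → Adj G u v → f u v ≡ f v u)
    × (∀ (i : Fin t) → LinearForest k (λ u v → Adj G u v × (f u v ≡ i)))

la≤ : ℕ → Graph → ℕ → Set
la≤ k G n = Σ ℕ λ t → (t ≤ n) × LinDecomp k G t

la≥ : ℕ → Graph → ℕ → Set
la≥ k G n = ∀ t → LinDecomp k G t → n ≤ t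

laBetween : ℕ → Graph → ℕ → ℕ → Set
laBetween k G lo hi = la≥ k G lo × la≤ k G hi

sufProdSum : List ℕ → ℕ
sufProdSum [] = 0
sufProdSum (x ∷ xs) = product (x ∷ xs) + sufProdSum xs

module Submission where

-- Upper bounds: every graph here has a proper edge colouring with few colours, and each colour
-- class, being a matching, is a linear 1-forest.  A cycle needs 3 colours; colourings of the
-- factors combine into one of a product: disjoint palettes for the two kinds of edges of a
-- Cartesian product, pairs of colours for a direct product, and for a lexicographic product a
-- Latin square (addition modulo |V(H)|) on the complete bipartite graph between adjacent layers.
-- Lower bounds: in a linear forest a vertex has at most one successor and one predecessor, so a
-- vertex with d distinct neighbours needs at least d/2 forests; and one linear forest cannot
-- cover a graph of minimum degree 2, whose first vertex on a path would need two successors.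

open import Defs
open import Data.Bool using (if_then_else_)
open import Data.Empty using (⊥-elim)
open import Data.Fin as F using (Fin; toℕ; fromℕ; inject₁; join; combine)
open import Data.Fin.Patterns using (0F; 1F; 2F)
open import Data.Fin.Properties as FP
  using (toℕ-injective; toℕ<n; toℕ-fromℕ; toℕ-fromℕ<; toℕ-inject₁; ¬Fin0; injective⇒≤;
         combine-injective; inj⇒≟; +↔⊎; *↔×)
open import Data.Fin.Relation.Unary.Top using (view; ‵fromℕ; ‵inject₁)
open import Data.List
  using (List; []; _∷_; _++_; concat; map; filter; tabulate; cartesianProduct; foldl; length)
open import Data.List.Membership.Propositional using (_∈_; lose)
open import Data.List.Membership.Propositional.Properties
  using (∈-filter⁺; ∈-cartesianProduct⁺; ∈-tabulate⁺)
open import Data.List.Relation.Binary.Disjoint.Propositional using (Disjoint)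
open import Data.List.Relation.Unary.All as All using (All; []; _∷_)
import Data.List.Relation.Unary.All.Properties as AllP
open import Data.List.Relation.Unary.AllPairs using (AllPairs; []; _∷_)
import Data.List.Relation.Unary.AllPairs.Properties as AllPairsP
open import Data.List.Relation.Unary.Any using (Any; here; there)
import Data.List.Relation.Unary.Any.Properties as AnyP
open import Data.List.Relation.Unary.Unique.Propositional using (Unique)
open import Data.List.Relation.Unary.Unique.Propositional.Properties as UniqueP
  using (Unique[x∷xs]⇒x∉xs)
open import Data.Nat as ℕ
  using (ℕ; zero; suc; _+_; _*_; _^_; _∸_; _%_; _/_; _≤_; _<_; z≤n; s≤s; NonZero)
open import Data.Nat.DivMod
  using (_mod_; %-distribˡ-+; m%n%n≡m%n; [m+kn]%n≡m%n; m<n⇒m%n≡m; m%n≤n; m≡m%n+[m/n]*n;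
         m*n/n≡m; /-monoˡ-≤)
open import Data.Nat.ListAction using (product)
open import Data.Nat.Properties
  using (+-comm; +-assoc; +-suc; +-identityʳ; *-comm; *-assoc; *-suc; *-identityʳ;
         +-cancelˡ-≡; +-cancelʳ-≡; suc-injective; m≢1+n+m; m+[n∸m]≡n; m+n∸n≡m;
         ≤-refl; ≤-trans; ≤-reflexive; <⇒≢; +-mono-≤; *-monoˡ-≤; *-monoʳ-≤; *-cancelˡ-≤;
         ^-monoˡ-≤; m≤m+n; m≤n+m; m^n>0; module ≤-Reasoning)
open import Data.Nat.Solver using (module +-*-Solver)
open import Data.Product using (Σ; ∃; _×_; _,_; proj₁; proj₂)
open import Data.Product.Function.NonDependent.Propositional using (_×-↔_)
open import Data.Product.Properties using (×-≡,≡→≡; ,-injective)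
open import Data.Sum as Sum using (_⊎_; inj₁; inj₂)
open import Data.Sum.Properties using (inj₁-injective; inj₂-injective)
open import Function using (_∘_; case_of_; _↔_; Inverse; Injection)
open import Function.Definitions using (Injective)
open import Function.Properties.Inverse using (↔-refl; ↔-sym; ↔-trans; ↔⇒↣)
open import Relation.Binary.Definitions using (DecidableEquality; tri<; tri≈; tri>)
open import Relation.Binary.PropositionalEquality
  using (_≡_; _≢_; refl; sym; trans; cong; cong₂; subst; module ≡-Reasoning)
open import Relation.Nullary using (¬_; Dec; yes; no; does; contradiction)
open import Relation.Nullary.Decidable using (_×-dec_; _⊎-dec_; dec-true; dec-false)

open +-*-Solver using (solve; _:+_; _:*_; _:=_; con)

-- Paths as lists of vertices

module _ {A : Set} where

  Step⇒∈ˡ : ∀ {u v : A} {L} → Step u v L → u ∈ L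
  Step⇒∈ˡ here = here refl
  Step⇒∈ˡ (there s) = there (Step⇒∈ˡ s)

  Step⇒∈ʳ : ∀ {u v : A} {L} → Step u v L → v ∈ L
  Step⇒∈ʳ here = there (here refl)
  Step⇒∈ʳ (there s) = there (Step⇒∈ʳ s)

  Step-into-head : ∀ {u v : A} {L} → Step u v (v ∷ L) → v ∈ L
  Step-into-head here = here refl
  Step-into-head (there s) = Step⇒∈ʳ s

  Step-functional : ∀ {u v w : A} {L} → Unique L → Step u v L → Step u w L → v ≡ w
  Step-functional _ here here = refl
  Step-functional U here (there s) = contradiction (Step⇒∈ˡ s) (Unique[x∷xs]⇒x∉xs U)
  Step-functional U (there s) here = contradiction (Step⇒∈ˡ s) (Unique[x∷xs]⇒x∉xs U)
  Step-functional (_ ∷ U) (there s) (there t) = Step-functional U s t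

  Step-injective : ∀ {u v w : A} {L} → Unique L → Step v u L → Step w u L → v ≡ w
  Step-injective _ here here = refl
  Step-injective (_ ∷ U) here (there s) = contradiction (Step-into-head s) (Unique[x∷xs]⇒x∉xs U)
  Step-injective (_ ∷ U) (there s) here = contradiction (Step-into-head s) (Unique[x∷xs]⇒x∉xs U)
  Step-injective (_ ∷ U) (there s) (there t) = Step-injective U s t

  Step-++ˡ : ∀ {u v : A} {L} M → Step u v L → Step u v (L ++ M)
  Step-++ˡ M here = here
  Step-++ˡ M (there s) = there (Step-++ˡ M s)

  Step-++ʳ : ∀ {u v : A} L {M} → Step u v M → Step u v (L ++ M)
  Step-++ʳ [] s = s
  Step-++ʳ (x ∷ L) s = there (Step-++ʳ L s)

  Any-Step⇒Step-concat : ∀ {u v : A} {Ls} → Any (Step u v) Ls → Step u v (concat Ls)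
  Any-Step⇒Step-concat {Ls = L ∷ Ls} (here s) = Step-++ˡ (concat Ls) s
  Any-Step⇒Step-concat {Ls = L ∷ Ls} (there a) = Step-++ʳ L (Any-Step⇒Step-concat a)

  Incident : List A → A → A → Set
  Incident L u v = Step u v L ⊎ Step v u L

  side : ∀ {L} {u v : A} → Incident L u v → Fin 2
  side (inj₁ _) = 0F
  side (inj₂ _) = 1F

  Incident-injective : ∀ {L} {u v w : A} → Unique L →
    (p : Incident L u v) (q : Incident L u w) → side p ≡ side q → v ≡ w
  Incident-injective U (inj₁ s) (inj₁ t) _ = Step-functional U s t
  Incident-injective U (inj₂ s) (inj₂ t) _ = Step-injective U s t

-- Lower bounds

record DistinctNeighbours {A : Set} (E : A → A → Set) (x : A) (d : ℕ) : Set where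
  field
    neighbour : Fin d → A
    adjacent  : ∀ i → E x (neighbour i)
    injective : Injective _≡_ _≡_ neighbour

module _ {k t : ℕ} {G : Graph} (D : LinDecomp k G t) where
  private
    f : V G → V G → Fin t
    f = proj₁ D
    forest : ∀ c → LinearForest k (λ u v → Adj G u v × (f u v ≡ c))
    forest = proj₂ (proj₂ D)

  -- The paths of colour c laid end to end; every edge of colour c is a consecutive pair in it.
  trail : Fin t → List (V G)
  trail c = let (paths , _) = forest c in concat paths

  trail-unique : ∀ c → Unique (trail c)
  trail-unique c = let (_ , _ , unique , _) = forest c in unique

  incident : ∀ {u v} → Adj G u v → Incident (trail (f u v)) u v
  incident {u} {v} a = let (_ , _ , _ , _ , cover) = forest (f u v) in
    Sum.map Any-Step⇒Step-concat Any-Step⇒Step-concat (cover u v (a , refl))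

  -- A neighbour is determined by the colour of its edge and by its side of x on that trail.
  degree≤2*forests : ∀ {x d} → DistinctNeighbours (Adj G) x d → d ≤ 2 * t
  degree≤2*forests {x} N = injective⇒≤ key-injective
    where
      open DistinctNeighbours N
      colour : Fin _ → Fin t
      colour i = f x (neighbour i)
      key : Fin _ → Fin (2 * t)
      key i = combine (side (incident (adjacent i))) (colour i)
      same-colour : ∀ {c c' v w} → c ≡ c' → (p : Incident (trail c) x v) (q : Incident (trail c') x w) →
                    side p ≡ side q → v ≡ w
      same-colour {c} refl = Incident-injective (trail-unique c)
      key-injective : Injective _≡_ _≡_ key
      key-injective {i} {j} eq =
        let (same-side , same-c) = combine-injective _ (colour i) _ (colour j) eq
        in injective (same-colour same-c (incident (adjacent i)) (incident (adjacent j)) same-side)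

MinDegree2 : Graph → Set
MinDegree2 G = V G × (∀ x → DistinctNeighbours (Adj G) x 2)

-- The first vertex of the list would need two distinct successors.
min-degree-2⇒¬covering-trail : ∀ {G : Graph} {L} → MinDegree2 G → Unique L →
  ¬ (∀ {u v} → Adj G u v → Incident L u v)
min-degree-2⇒¬covering-trail {L = []} (x , N) _ cover with cover (DistinctNeighbours.adjacent (N x) 0F)
... | inj₁ ()
... | inj₂ ()
min-degree-2⇒¬covering-trail {L = h ∷ L} (_ , N) U cover =
  case injective (Step-functional U (forward 0F) (forward 1F)) of λ ()
  where
    open DistinctNeighbours (N h)
    forward : ∀ i → Step h (neighbour i) (h ∷ L)
    forward i with cover (adjacent i)
    ... | inj₁ s = s
    ... | inj₂ s = contradiction (Step-into-head s) (Unique[x∷xs]⇒x∉xs U)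

la≥2 : ∀ {k} {G : Graph} → MinDegree2 G → la≥ k G 2
la≥2 (x , _) zero (f , _) = ⊥-elim (¬Fin0 (f x x))
la≥2 {G = G} δ (suc zero) D = ⊥-elim (min-degree-2⇒¬covering-trail δ (trail-unique D 0F) one-colour)
  where
    only-colour : (c : Fin 1) → c ≡ 0F
    only-colour 0F = refl
    one-colour : ∀ {u v} → Adj G u v → Incident (trail D 0F) u v
    one-colour {u} {v} a = subst (λ c → Incident (trail D c) u v) (only-colour _) (incident D a)
la≥2 _ (suc (suc t)) _ = s≤s (s≤s z≤n)

-- Upper bounds

record FiniteSimpleGraph (G : Graph) : Set where
  field
    order      : ℕ
    index      : V G ↔ Fin order
    adjacent?  : ∀ u v → Dec (Adj G u v)
    adj-sym    : ∀ {u v} → Adj G u v → Adj G v u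
    adj-irrefl : ∀ {u} → ¬ Adj G u u

  adj⇒≢ : ∀ {u v} → Adj G u v → u ≢ v
  adj⇒≢ a refl = adj-irrefl a

  _≟_ : DecidableEquality (V G)
  _≟_ = inj⇒≟ (↔⇒↣ index)

record ProperEdgeColouring {A : Set} (E : A → A → Set) (t : ℕ) : Set where
  field
    colour     : A → A → Fin t
    colour-sym : ∀ {u v} → E u v → colour u v ≡ colour v u
    proper     : ∀ {u v w} → E u v → E u w → colour u v ≡ colour u w → v ≡ w

AllPairs-restrict : ∀ {A : Set} {P : A → Set} {R S : A → A → Set} →
  (∀ {x y} → P x → P y → R x y → S x y) → ∀ {xs} → All P xs → AllPairs R xs → AllPairs S xs
AllPairs-restrict imp [] [] = []
AllPairs-restrict imp (px ∷ pxs) (rs ∷ rss) =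
  All.zipWith (λ (py , r) → imp px py r) (pxs , rs) ∷ AllPairs-restrict imp pxs rss

-- Each edge of the matching becomes a path u ∷ v ∷ [], oriented so that u comes first in the index.
module Matching {A : Set} {n : ℕ} (index : A ↔ Fin n) {M : A → A → Set} (M? : ∀ u v → Dec (M u v))
  (M-sym : ∀ {u v} → M u v → M v u) (M-irrefl : ∀ {u} → ¬ M u u)
  (M-functional : ∀ {u v w} → M u v → M u w → v ≡ w) where

  open Inverse index using (to; from; strictlyInverseʳ)

  Oriented : A × A → Set
  Oriented (u , v) = M u v × to u F.< to v

  oriented? : ∀ e → Dec (Oriented e)
  oriented? (u , v) = M? u v ×-dec (to u FP.<? to v)

  vertices : List A
  vertices = tabulate from

  ∈-vertices : ∀ u → u ∈ vertices
  ∈-vertices u = subst (_∈ vertices) (strictlyInverseʳ u) (∈-tabulate⁺ (to u))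

  vertices-unique : Unique vertices
  vertices-unique = UniqueP.tabulate⁺ (Injection.injective (↔⇒↣ (↔-sym index)))

  edges : List (A × A)
  edges = filter oriented? (cartesianProduct vertices vertices)

  edges-oriented : All Oriented edges
  edges-oriented = AllP.all-filter oriented? (cartesianProduct vertices vertices)

  path : A × A → List A
  path (u , v) = u ∷ v ∷ []

  path-unique : ∀ {e} → Oriented e → Unique (path e)
  path-unique (_ , lt) = ((λ { refl → FP.<-irrefl refl lt }) ∷ []) ∷ [] ∷ []

  paths-disjoint : ∀ {e e'} → Oriented e → Oriented e' → e ≢ e' → Disjoint (path e) (path e')
  paths-disjoint (m , _) (m' , _) e≢e' (here refl , here refl) = e≢e' (cong (_ ,_) (M-functional m m'))
  paths-disjoint (m , lt) (m' , lt') _ (here refl , there (here refl))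
    with refl ← M-functional m (M-sym m') = FP.<-asym lt lt'
  paths-disjoint (m , lt) (m' , lt') _ (there (here refl) , here refl)
    with refl ← M-functional (M-sym m) m' = FP.<-asym lt lt'
  paths-disjoint (m , _) (m' , _) e≢e' (there (here refl) , there (here refl))
    with refl ← M-functional (M-sym m) (M-sym m') = e≢e' refl

  Step-oriented : ∀ {e a b} → Oriented e → Step a b (path e) → M a b
  Step-oriented (m , _) here = m
  Step-oriented _ (there (there ()))

  listed : ∀ {a b} → M a b → to a F.< to b → Any (Step a b) (map path edges)
  listed {a} {b} m lt = AnyP.map⁺ (lose (∈-filter⁺ oriented? ab∈ (m , lt)) here)
    where
      ab∈ : (a , b) ∈ cartesianProduct vertices vertices
      ab∈ = ∈-cartesianProduct⁺ (∈-vertices a) (∈-vertices b)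

  linearForest : ∀ {k} → 1 ≤ k → LinearForest k M
  linearForest {k} 1≤k = map path edges , short , unique , sound , complete
    where
      short : All (λ p → length p ≤ suc k) (map path edges)
      short = AllP.map⁺ (All.universal (λ _ → s≤s 1≤k) edges)
      unique : Unique (concat (map path edges))
      unique = UniqueP.concat⁺ (AllP.map⁺ (All.map path-unique edges-oriented))
        (AllPairsP.map⁺ (AllPairs-restrict paths-disjoint edges-oriented
          (UniqueP.filter⁺ oriented? (UniqueP.cartesianProduct⁺ vertices-unique vertices-unique))))
      sound : ∀ a b → Any (Step a b) (map path edges) → M a b
      sound a b s = let (o , st) = All.lookupAny edges-oriented (AnyP.map⁻ s) in Step-oriented o st
      complete : ∀ a b → M a b → Any (Step a b) (map path edges) ⊎ Any (Step b a) (map path edges)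
      complete a b m with FP.<-cmp (to a) (to b)
      ... | tri< lt _ _ = inj₁ (listed m lt)
      ... | tri≈ _ eq _ = ⊥-elim (M-irrefl (subst (M a) (sym (Injection.injective (↔⇒↣ index) eq)) m))
      ... | tri> _ _ gt = inj₂ (listed (M-sym m) gt)

colouring⇒LinDecomp : ∀ {k t} {G : Graph} → FiniteSimpleGraph G → ProperEdgeColouring (Adj G) t →
  1 ≤ k → LinDecomp k G t
colouring⇒LinDecomp {G = G} F χ 1≤k = colour , (λ _ _ → colour-sym) , λ c →
  Matching.linearForest index (λ u v → adjacent? u v ×-dec (colour u v FP.≟ c))
    (λ (a , e) → adj-sym a , trans (sym (colour-sym a)) e)
    (λ (a , _) → adj-irrefl a)
    (λ (a , e) (a' , e') → proper a a' (trans e (sym e')))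
    1≤k
  where
    open FiniteSimpleGraph F
    open ProperEdgeColouring χ

-- Products

_⊕_ : ∀ {n} → Fin n → Fin n → Fin n
_⊕_ {suc n} i j = (toℕ i + toℕ j) mod suc n

⊕-comm : ∀ {n} (i j : Fin n) → i ⊕ j ≡ j ⊕ i
⊕-comm {suc n} i j = cong (_mod suc n) (+-comm (toℕ i) (toℕ j))

%-undo-+ : ∀ a b n .{{_ : NonZero n}} → b < n → ((a + b) % n + (n ∸ a % n)) % n ≡ b
%-undo-+ a b n b<n = begin
  ((a + b) % n + (n ∸ a % n)) % n         ≡⟨ %-absorb-% (a + b) (n ∸ a % n) ⟩
  (a + b + (n ∸ a % n)) % n               ≡⟨ cong (_% n) shuffle ⟩
  (b + suc (a / n) * n) % n               ≡⟨ [m+kn]%n≡m%n b (suc (a / n)) n ⟩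
  b % n                                   ≡⟨ m<n⇒m%n≡m b<n ⟩
  b                                       ∎
  where
    open ≡-Reasoning
    %-absorb-% : ∀ x y → (x % n + y) % n ≡ (x + y) % n
    %-absorb-% x y = begin
      (x % n + y) % n             ≡⟨ %-distribˡ-+ (x % n) y n ⟩
      (x % n % n + y % n) % n     ≡⟨ cong (λ z → (z + y % n) % n) (m%n%n≡m%n x n) ⟩
      (x % n + y % n) % n         ≡⟨ %-distribˡ-+ x y n ⟨
      (x + y) % n                 ∎
    shuffle : a + b + (n ∸ a % n) ≡ b + suc (a / n) * n
    shuffle = begin
      a + b + (n ∸ a % n)                       ≡⟨ cong (λ z → z + b + (n ∸ a % n)) (m≡m%n+[m/n]*n a n) ⟩
      a % n + a / n * n + b + (n ∸ a % n)       ≡⟨ solve 4 (λ r q b s → r :+ q :+ b :+ s := b :+ (r :+ s) :+ q)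
                                                     refl (a % n) (a / n * n) b (n ∸ a % n) ⟩
      b + (a % n + (n ∸ a % n)) + a / n * n     ≡⟨ cong (λ z → b + z + a / n * n) (m+[n∸m]≡n (m%n≤n a n)) ⟩
      b + n + a / n * n                         ≡⟨ +-assoc b n (a / n * n) ⟩
      b + suc (a / n) * n                       ∎

⊕-cancelˡ : ∀ {n} (i : Fin n) {j k} → i ⊕ j ≡ i ⊕ k → j ≡ k
⊕-cancelˡ {suc n} i {j} {k} eq = toℕ-injective (begin
  toℕ j                          ≡⟨ %-undo-+ (toℕ i) (toℕ j) (suc n) (toℕ<n j) ⟨
  undo ((toℕ i + toℕ j) % suc n) ≡⟨ cong undo sum≡ ⟩
  undo ((toℕ i + toℕ k) % suc n) ≡⟨ %-undo-+ (toℕ i) (toℕ k) (suc n) (toℕ<n k) ⟩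
  toℕ k                          ∎)
  where
    open ≡-Reasoning
    undo : ℕ → ℕ
    undo r = (r + (suc n ∸ toℕ i % suc n)) % suc n
    sum≡ : (toℕ i + toℕ j) % suc n ≡ (toℕ i + toℕ k) % suc n
    sum≡ = trans (sym (toℕ-fromℕ< _)) (trans (cong toℕ eq) (toℕ-fromℕ< _))

join-injective : ∀ m n → Injective _≡_ _≡_ (join m n)
join-injective m n = Injection.injective (↔⇒↣ (↔-sym (+↔⊎ {m} {n})))

module _ {A B : Set} where

  Layerˡ : (A → A → Set) → A × B → A × B → Set
  Layerˡ E p q = proj₂ p ≡ proj₂ q × E (proj₁ p) (proj₁ q)

  Layerʳ : (B → B → Set) → A × B → A × B → Set
  Layerʳ F p q = proj₁ p ≡ proj₁ q × F (proj₂ p) (proj₂ q)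

  Lifted : (A → A → Set) → A × B → A × B → Set
  Lifted E p q = E (proj₁ p) (proj₁ q)

  Both : (A → A → Set) → (B → B → Set) → A × B → A × B → Set
  Both E F p q = E (proj₁ p) (proj₁ q) × F (proj₂ p) (proj₂ q)

_∪_ : ∀ {A : Set} → (A → A → Set) → (A → A → Set) → A → A → Set
(E₁ ∪ E₂) u v = E₁ u v ⊎ E₂ u v

-- The colour must be a function of the two endpoints, so the two edge sets are told apart by Q.
colouring-∪ : ∀ {A : Set} {E₁ E₂ : A → A → Set} {s t} (Q : A → A → Set) → (∀ u v → Dec (Q u v)) →
  (∀ {u v} → Q u v → Q v u) → (∀ {u v} → E₁ u v → Q u v) → (∀ {u v} → E₂ u v → ¬ Q u v) →
  ProperEdgeColouring E₁ s → ProperEdgeColouring E₂ t → ProperEdgeColouring (E₁ ∪ E₂) (s + t)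
colouring-∪ {A} {E₁} {E₂} {s} {t} Q Q? Q-sym E₁⇒Q E₂⇒¬Q χ₁ χ₂ = record
  { colour = λ u v → join s t (tagged u v) ; colour-sym = colour-sym ; proper = proper }
  where
    module χ₁ = ProperEdgeColouring χ₁
    module χ₂ = ProperEdgeColouring χ₂
    tagged : A → A → Fin s ⊎ Fin t
    tagged u v = if does (Q? u v) then inj₁ (χ₁.colour u v) else inj₂ (χ₂.colour u v)
    tagged₁ : ∀ {u v} → Q u v → tagged u v ≡ inj₁ (χ₁.colour u v)
    tagged₁ {u} {v} q rewrite dec-true (Q? u v) q = refl
    tagged₂ : ∀ {u v} → ¬ Q u v → tagged u v ≡ inj₂ (χ₂.colour u v)
    tagged₂ {u} {v} ¬q rewrite dec-false (Q? u v) ¬q = refl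
    on₁ : ∀ {u v} → E₁ u v → tagged u v ≡ inj₁ (χ₁.colour u v)
    on₁ = tagged₁ ∘ E₁⇒Q
    on₂ : ∀ {u v} → E₂ u v → tagged u v ≡ inj₂ (χ₂.colour u v)
    on₂ = tagged₂ ∘ E₂⇒¬Q
    colour-sym : ∀ {u v} → (E₁ ∪ E₂) u v → join s t (tagged u v) ≡ join s t (tagged v u)
    colour-sym (inj₁ e) = cong (join s t) (begin
      tagged _ _           ≡⟨ on₁ e ⟩
      inj₁ (χ₁.colour _ _) ≡⟨ cong inj₁ (χ₁.colour-sym e) ⟩
      inj₁ (χ₁.colour _ _) ≡⟨ tagged₁ (Q-sym (E₁⇒Q e)) ⟨
      tagged _ _           ∎)
      where open ≡-Reasoning
    colour-sym (inj₂ e) = cong (join s t) (begin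
      tagged _ _           ≡⟨ on₂ e ⟩
      inj₂ (χ₂.colour _ _) ≡⟨ cong inj₂ (χ₂.colour-sym e) ⟩
      inj₂ (χ₂.colour _ _) ≡⟨ tagged₂ (E₂⇒¬Q e ∘ Q-sym) ⟨
      tagged _ _           ∎)
      where open ≡-Reasoning
    proper : ∀ {u v w} → (E₁ ∪ E₂) u v → (E₁ ∪ E₂) u w →
             join s t (tagged u v) ≡ join s t (tagged u w) → v ≡ w
    proper {u} {v} {w} e e' eq with same ← join-injective s t {tagged u v} {tagged u w} eq | e | e'
    ... | inj₁ a | inj₁ b = χ₁.proper a b (inj₁-injective (trans (sym (on₁ a)) (trans same (on₁ b))))
    ... | inj₂ a | inj₂ b = χ₂.proper a b (inj₂-injective (trans (sym (on₂ a)) (trans same (on₂ b))))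
    ... | inj₁ a | inj₂ b with () ← trans (sym (on₁ a)) (trans same (on₂ b))
    ... | inj₂ a | inj₁ b with () ← trans (sym (on₂ a)) (trans same (on₁ b))

module _ {A B : Set} where

  layerˡ-colouring : ∀ {E : A → A → Set} {t} →
    ProperEdgeColouring E t → ProperEdgeColouring (Layerˡ {B = B} E) t
  layerˡ-colouring χ = record
    { colour = λ p q → colour (proj₁ p) (proj₁ q)
    ; colour-sym = λ (_ , e) → colour-sym e
    ; proper = λ (eq , e) (eq' , e') same → ×-≡,≡→≡ (proper e e' same , trans (sym eq) eq') }
    where open ProperEdgeColouring χ

  layerʳ-colouring : ∀ {F : B → B → Set} {t} →
    ProperEdgeColouring F t → ProperEdgeColouring (Layerʳ {A = A} F) t
  layerʳ-colouring χ = record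
    { colour = λ p q → colour (proj₂ p) (proj₂ q)
    ; colour-sym = λ (_ , e) → colour-sym e
    ; proper = λ (eq , e) (eq' , e') same → ×-≡,≡→≡ (trans (sym eq) eq' , proper e e' same) }
    where open ProperEdgeColouring χ

  both-colouring : ∀ {E : A → A → Set} {F : B → B → Set} {s t} →
    ProperEdgeColouring E s → ProperEdgeColouring F t → ProperEdgeColouring (Both E F) (s * t)
  both-colouring χ ψ = record
    { colour = λ p q → combine (χ.colour (proj₁ p) (proj₁ q)) (ψ.colour (proj₂ p) (proj₂ q))
    ; colour-sym = λ (e , f) → cong₂ combine (χ.colour-sym e) (ψ.colour-sym f)
    ; proper = λ (e , f) (e' , f') same →
        let (same₁ , same₂) = combine-injective _ _ _ _ same
        in ×-≡,≡→≡ (χ.proper e e' same₁ , ψ.proper f f' same₂) }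
    where
      module χ = ProperEdgeColouring χ
      module ψ = ProperEdgeColouring ψ

  -- Between two adjacent layers the edges form a complete bipartite graph, coloured by a Latin square.
  lifted-colouring : ∀ {E : A → A → Set} {s n} → B ↔ Fin n → ProperEdgeColouring E s →
    ProperEdgeColouring (Lifted {B = B} E) (s * n)
  lifted-colouring index χ = record
    { colour = λ p q → combine (colour (proj₁ p) (proj₁ q)) (to (proj₂ p) ⊕ to (proj₂ q))
    ; colour-sym = λ {p} {q} e → cong₂ combine (colour-sym e) (⊕-comm (to (proj₂ p)) (to (proj₂ q)))
    ; proper = λ {p} e e' same →
        let (same₁ , same₂) = combine-injective _ _ _ _ same
        in ×-≡,≡→≡ (proper e e' same₁ , Injection.injective (↔⇒↣ index) (⊕-cancelˡ (to (proj₂ p)) same₂)) }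
    where
      open ProperEdgeColouring χ
      open Inverse index using (to)

reindexed-neighbours : ∀ {A B : Set} {E : A → A → Set} {x d} → Fin d ↔ B → (neighbour : B → A) →
  (∀ b → E x (neighbour b)) → Injective _≡_ _≡_ neighbour → DistinctNeighbours E x d
reindexed-neighbours I neighbour adjacent injective = record
  { neighbour = neighbour ∘ to ; adjacent = adjacent ∘ to
  ; injective = Injection.injective (↔⇒↣ I) ∘ injective }
  where open Inverse I using (to)

neighbours-mono : ∀ {A : Set} {E F : A → A → Set} {x d} → (∀ {v} → E x v → F x v) →
  DistinctNeighbours E x d → DistinctNeighbours F x d
neighbours-mono E⇒F N = record { neighbour = neighbour ; adjacent = E⇒F ∘ adjacent ; injective = injective }
  where open DistinctNeighbours N

neighbours-∪ : ∀ {A : Set} {E₁ E₂ : A → A → Set} {x d e} →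
  DistinctNeighbours E₁ x d → DistinctNeighbours E₂ x e → (∀ {a b} → E₁ x a → E₂ x b → a ≢ b) →
  DistinctNeighbours (E₁ ∪ E₂) x (d + e)
neighbours-∪ {A} {E₁} {E₂} {x} {d} {e} N₁ N₂ apart = reindexed-neighbours +↔⊎ neighbour adjacent injective
  where
    module N₁ = DistinctNeighbours N₁
    module N₂ = DistinctNeighbours N₂
    neighbour : Fin d ⊎ Fin e → A
    neighbour = Sum.[ N₁.neighbour , N₂.neighbour ]
    adjacent : ∀ b → (E₁ ∪ E₂) x (neighbour b)
    adjacent (inj₁ i) = inj₁ (N₁.adjacent i)
    adjacent (inj₂ j) = inj₂ (N₂.adjacent j)
    injective : Injective _≡_ _≡_ neighbour
    injective {inj₁ i} {inj₁ j} eq = cong inj₁ (N₁.injective eq)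
    injective {inj₂ i} {inj₂ j} eq = cong inj₂ (N₂.injective eq)
    injective {inj₁ i} {inj₂ j} eq = ⊥-elim (apart (N₁.adjacent i) (N₂.adjacent j) eq)
    injective {inj₂ i} {inj₁ j} eq = ⊥-elim (apart (N₁.adjacent j) (N₂.adjacent i) (sym eq))

module _ {A B : Set} where

  layerˡ-neighbours : ∀ {E : A → A → Set} {x d} (y : B) → DistinctNeighbours E x d →
    DistinctNeighbours (Layerˡ E) (x , y) d
  layerˡ-neighbours y N = record
    { neighbour = λ i → neighbour i , y ; adjacent = λ i → refl , adjacent i
    ; injective = injective ∘ proj₁ ∘ ,-injective }
    where open DistinctNeighbours N

  layerʳ-neighbours : ∀ {F : B → B → Set} {y e} (x : A) → DistinctNeighbours F y e →
    DistinctNeighbours (Layerʳ F) (x , y) e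
  layerʳ-neighbours x N = record
    { neighbour = λ j → x , neighbour j ; adjacent = λ j → refl , adjacent j
    ; injective = injective ∘ proj₂ ∘ ,-injective }
    where open DistinctNeighbours N

  both-neighbours : ∀ {E : A → A → Set} {F : B → B → Set} {x y d e} →
    DistinctNeighbours E x d → DistinctNeighbours F y e → DistinctNeighbours (Both E F) (x , y) (d * e)
  both-neighbours N M = reindexed-neighbours *↔×
    (λ (i , j) → N.neighbour i , M.neighbour j)
    (λ (i , j) → N.adjacent i , M.adjacent j)
    (λ eq → let (eq₁ , eq₂) = ,-injective eq in ×-≡,≡→≡ (N.injective eq₁ , M.injective eq₂))
    where
      module N = DistinctNeighbours N
      module M = DistinctNeighbours M

  lifted-neighbours : ∀ {E : A → A → Set} {x d n} (y : B) → B ↔ Fin n → DistinctNeighbours E x d →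
    DistinctNeighbours (Lifted E) (x , y) (d * n)
  lifted-neighbours y index N = reindexed-neighbours *↔×
    (λ (i , j) → neighbour i , from j)
    (λ (i , _) → adjacent i)
    (λ eq → let (eq₁ , eq₂) = ,-injective eq
            in ×-≡,≡→≡ (injective eq₁ , Injection.injective (↔⇒↣ (↔-sym index)) eq₂))
    where
      open DistinctNeighbours N
      open Inverse index using (from)

module Products {G H : Graph} (FG : FiniteSimpleGraph G) (FH : FiniteSimpleGraph H) where
  private
    module G = FiniteSimpleGraph FG
    module H = FiniteSimpleGraph FH

  product-index : (V G × V H) ↔ Fin (G.order * H.order)
  product-index = ↔-trans (G.index ×-↔ H.index) (↔-sym *↔×)

  □-finite : FiniteSimpleGraph (G □ H)
  □-finite = record
    { order = G.order * H.order ; index = product-index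
    ; adjacent? = λ p q → (proj₁ p G.≟ proj₁ q ×-dec H.adjacent? (proj₂ p) (proj₂ q))
                     ⊎-dec (proj₂ p H.≟ proj₂ q ×-dec G.adjacent? (proj₁ p) (proj₁ q))
    ; adj-sym = Sum.map (λ (eq , a) → sym eq , H.adj-sym a) (λ (eq , a) → sym eq , G.adj-sym a)
    ; adj-irrefl = Sum.[ H.adj-irrefl ∘ proj₂ , G.adj-irrefl ∘ proj₂ ] }

  ∘ₗ-finite : FiniteSimpleGraph (G ∘ₗ H)
  ∘ₗ-finite = record
    { order = G.order * H.order ; index = product-index
    ; adjacent? = λ p q → G.adjacent? (proj₁ p) (proj₁ q)
                     ⊎-dec (proj₁ p G.≟ proj₁ q ×-dec H.adjacent? (proj₂ p) (proj₂ q))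
    ; adj-sym = Sum.map G.adj-sym (λ (eq , a) → sym eq , H.adj-sym a)
    ; adj-irrefl = Sum.[ G.adj-irrefl , H.adj-irrefl ∘ proj₂ ] }

  ×ᵍ-finite : FiniteSimpleGraph (G ×ᵍ H)
  ×ᵍ-finite = record
    { order = G.order * H.order ; index = product-index
    ; adjacent? = λ p q → G.adjacent? (proj₁ p) (proj₁ q) ×-dec H.adjacent? (proj₂ p) (proj₂ q)
    ; adj-sym = λ (a , b) → G.adj-sym a , H.adj-sym b
    ; adj-irrefl = G.adj-irrefl ∘ proj₁ }

  ⊠-finite : FiniteSimpleGraph (G ⊠ H)
  ⊠-finite = record
    { order = G.order * H.order ; index = product-index
    ; adjacent? = λ p q → □.adjacent? p q ⊎-dec ×ᵍ.adjacent? p q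
    ; adj-sym = Sum.map □.adj-sym ×ᵍ.adj-sym
    ; adj-irrefl = Sum.[ □.adj-irrefl , ×ᵍ.adj-irrefl ] }
    where
      module □ = FiniteSimpleGraph □-finite
      module ×ᵍ = FiniteSimpleGraph ×ᵍ-finite

  module _ {s t} (χ : ProperEdgeColouring (Adj G) s) (ψ : ProperEdgeColouring (Adj H) t) where

    □-colouring : ProperEdgeColouring (Adj (G □ H)) (t + s)
    □-colouring = colouring-∪ (λ p q → proj₁ p ≡ proj₁ q) (λ p q → proj₁ p G.≟ proj₁ q) sym proj₁
      (λ (_ , a) → G.adj⇒≢ a) (layerʳ-colouring ψ) (layerˡ-colouring χ)

    ∘ₗ-colouring : ProperEdgeColouring (Adj (G ∘ₗ H)) (s * H.order + t)
    ∘ₗ-colouring = colouring-∪ (Lifted (Adj G)) (λ p q → G.adjacent? (proj₁ p) (proj₁ q)) G.adj-sym (λ a → a)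
      (λ (eq , _) a → G.adj⇒≢ a eq) (lifted-colouring H.index χ) (layerʳ-colouring ψ)

    ⊠-colouring : ProperEdgeColouring (Adj (G ⊠ H)) ((t + s) + s * t)
    ⊠-colouring = colouring-∪ (λ p q → proj₁ p ≡ proj₁ q ⊎ proj₂ p ≡ proj₂ q)
      (λ p q → (proj₁ p G.≟ proj₁ q) ⊎-dec (proj₂ p H.≟ proj₂ q)) (Sum.map sym sym) (Sum.map proj₁ proj₁)
      (λ (a , b) → Sum.[ G.adj⇒≢ a , H.adj⇒≢ b ]) □-colouring (both-colouring χ ψ)

  module _ {x y d e} (N : DistinctNeighbours (Adj G) x d) (M : DistinctNeighbours (Adj H) y e) where

    □-neighbours : DistinctNeighbours (Adj (G □ H)) (x , y) (e + d)
    □-neighbours = neighbours-∪ (layerʳ-neighbours x M) (layerˡ-neighbours y N)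
      (λ (eq , _) (_ , a) same → G.adj⇒≢ a (trans eq (cong proj₁ same)))

    ∘ₗ-neighbours : DistinctNeighbours (Adj (G ∘ₗ H)) (x , y) (d * H.order + e)
    ∘ₗ-neighbours = neighbours-∪ (lifted-neighbours y H.index N) (layerʳ-neighbours x M)
      (λ a (eq , _) same → G.adj⇒≢ a (trans eq (cong proj₁ (sym same))))

    ⊠-neighbours : DistinctNeighbours (Adj (G ⊠ H)) (x , y) ((e + d) + d * e)
    ⊠-neighbours = neighbours-∪ □-neighbours (both-neighbours N M) apart
      where
        apart : ∀ {p q} → Adj (G □ H) (x , y) p → Adj (G ×ᵍ H) (x , y) q → p ≢ q
        apart (inj₁ (eq , _)) (g , _) same = G.adj⇒≢ g (trans eq (cong proj₁ same))
        apart (inj₂ (eq , _)) (_ , h) same = H.adj⇒≢ h (trans eq (cong proj₂ same))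

-- Cycles

successor : ∀ {k} (i : Fin (suc k)) → ∃ (CycSucc i)
successor i with view i
... | ‵fromℕ = 0F , inj₂ (cong suc (toℕ-fromℕ _) , refl)
... | ‵inject₁ j = F.suc j , inj₁ (cong suc (toℕ-inject₁ j))

predecessor : ∀ {k} (i : Fin (suc k)) → ∃ λ j → CycSucc j i
predecessor 0F = fromℕ _ , inj₂ (cong suc (toℕ-fromℕ _) , refl)
predecessor (F.suc j) = inject₁ j , inj₁ (cong suc (toℕ-inject₁ j))

parity : ℕ → Fin 3
parity zero = 0F
parity (suc zero) = 1F
parity (suc (suc n)) = parity n

parity≢2 : ∀ n → parity n ≢ 2F
parity≢2 zero ()
parity≢2 (suc zero) ()
parity≢2 (suc (suc n)) = parity≢2 n

parity-suc : ∀ n → parity (suc n) ≢ parity n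
parity-suc zero ()
parity-suc (suc zero) ()
parity-suc (suc (suc n)) = parity-suc n

module Cycle (n : ℕ) where
  private
    m : ℕ
    m = 3 + n

  CycSucc? : (i j : Fin m) → Dec (CycSucc i j)
  CycSucc? i j = (suc (toℕ i) ℕ.≟ toℕ j) ⊎-dec ((suc (toℕ i) ℕ.≟ m) ×-dec (toℕ j ℕ.≟ 0))

  CycSucc-functional : ∀ {i j k : Fin m} → CycSucc i j → CycSucc i k → j ≡ k
  CycSucc-functional (inj₁ e) (inj₁ e') = toℕ-injective (trans (sym e) e')
  CycSucc-functional {j = j} (inj₁ e) (inj₂ (e' , _)) = ⊥-elim (<⇒≢ (toℕ<n j) (trans (sym e) e'))
  CycSucc-functional {k = k} (inj₂ (e , _)) (inj₁ e') = ⊥-elim (<⇒≢ (toℕ<n k) (trans (sym e') e))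
  CycSucc-functional (inj₂ (_ , j≡0)) (inj₂ (_ , k≡0)) = toℕ-injective (trans j≡0 (sym k≡0))

  CycSucc-injective : ∀ {i j k : Fin m} → CycSucc j i → CycSucc k i → j ≡ k
  CycSucc-injective (inj₁ e) (inj₁ e') = toℕ-injective (suc-injective (trans e (sym e')))
  CycSucc-injective (inj₁ e) (inj₂ (_ , i≡0)) with () ← trans e i≡0
  CycSucc-injective (inj₂ (_ , i≡0)) (inj₁ e') with () ← trans e' i≡0
  CycSucc-injective (inj₂ (e , _)) (inj₂ (e' , _)) = toℕ-injective (suc-injective (trans e (sym e')))

  -- Both orientations would force m ≤ 2.
  CycSucc-asym : ∀ {i j : Fin m} → CycSucc i j → ¬ CycSucc j i
  CycSucc-asym {i} (inj₁ e) (inj₁ e') = m≢1+n+m (toℕ i) (sym (trans (cong suc e) e'))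
  CycSucc-asym (inj₁ e) (inj₂ (e' , i≡0)) with () ← trans (sym e') (cong suc (trans (sym e) (cong suc i≡0)))
  CycSucc-asym (inj₂ (e , j≡0)) (inj₁ e') with () ← trans (sym e) (cong suc (trans (sym e') (cong suc j≡0)))
  CycSucc-asym (inj₂ (e , _)) (inj₂ (_ , i≡0)) with () ← trans (sym e) (cong suc i≡0)

  finite : FiniteSimpleGraph (C m)
  finite = record
    { order = m ; index = ↔-refl
    ; adjacent? = λ i j → CycSucc? i j ⊎-dec CycSucc? j i
    ; adj-sym = Sum.swap
    ; adj-irrefl = Sum.[ (λ s → CycSucc-asym s s) , (λ s → CycSucc-asym s s) ] }

  neighbours : ∀ i → DistinctNeighbours (Adj (C m)) i 2
  neighbours i = record { neighbour = neighbour ; adjacent = adjacent ; injective = injective }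
    where
      neighbour : Fin 2 → Fin m
      neighbour 0F = proj₁ (successor i)
      neighbour 1F = proj₁ (predecessor i)
      adjacent : ∀ b → Adj (C m) i (neighbour b)
      adjacent 0F = inj₁ (proj₂ (successor i))
      adjacent 1F = inj₂ (proj₂ (predecessor i))
      injective : Injective _≡_ _≡_ neighbour
      injective {0F} {0F} _ = refl
      injective {1F} {1F} _ = refl
      injective {0F} {1F} eq =
        ⊥-elim (CycSucc-asym (proj₂ (successor i)) (subst (λ j → CycSucc j i) (sym eq) (proj₂ (predecessor i))))
      injective {1F} {0F} eq =
        ⊥-elim (CycSucc-asym (proj₂ (successor i)) (subst (λ j → CycSucc j i) eq (proj₂ (predecessor i))))

  forward : Fin m → Fin 3
  forward i = if does (suc (toℕ i) ℕ.≟ m) then 2F else parity (toℕ i)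

  forward-closing : ∀ {i} → suc (toℕ i) ≡ m → forward i ≡ 2F
  forward-closing {i} e rewrite dec-true (suc (toℕ i) ℕ.≟ m) e = refl

  forward-not-closing : ∀ {i} → suc (toℕ i) ≢ m → forward i ≡ parity (toℕ i)
  forward-not-closing {i} ne rewrite dec-false (suc (toℕ i) ℕ.≟ m) ne = refl

  forward-inner : ∀ {i j : Fin m} → suc (toℕ i) ≡ toℕ j → forward i ≡ parity (toℕ i)
  forward-inner {j = j} e = forward-not-closing (λ last → <⇒≢ (toℕ<n j) (trans (sym e) last))

  forward-differs : ∀ {i j} → CycSucc i j → forward i ≢ forward j
  forward-differs {i} {j} (inj₁ e) same with suc (toℕ j) ℕ.≟ m
  ... | yes last = parity≢2 (toℕ i) (trans (sym (forward-inner e)) (trans same (forward-closing last)))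
  ... | no inner = parity-suc (toℕ i) (begin
    parity (suc (toℕ i)) ≡⟨ cong parity e ⟩
    parity (toℕ j)       ≡⟨ forward-not-closing inner ⟨
    forward j            ≡⟨ same ⟨
    forward i            ≡⟨ forward-inner e ⟩
    parity (toℕ i)       ∎)
    where open ≡-Reasoning
  forward-differs {i} {j} (inj₂ (e , j≡0)) same = case 2≡0 of λ ()
    where
      open ≡-Reasoning
      2≡0 : 2F ≡ 0F
      2≡0 = begin
        2F             ≡⟨ forward-closing e ⟨
        forward i      ≡⟨ same ⟩
        forward j      ≡⟨ forward-not-closing (λ last → case trans (sym last) (cong suc j≡0) of λ ()) ⟩
        parity (toℕ j) ≡⟨ cong parity j≡0 ⟩
        0F             ∎

  colour : Fin m → Fin m → Fin 3
  colour i j = if does (CycSucc? i j) then forward i else forward j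

  colour-forward : ∀ {i j} → CycSucc i j → colour i j ≡ forward i
  colour-forward {i} {j} s rewrite dec-true (CycSucc? i j) s = refl

  colour-backward : ∀ {i j} → CycSucc j i → colour i j ≡ forward j
  colour-backward {i} {j} s rewrite dec-false (CycSucc? i j) (CycSucc-asym s) = refl

  colouring : ProperEdgeColouring (Adj (C m)) 3
  colouring = record { colour = colour ; colour-sym = colour-sym ; proper = proper }
    where
      colour-sym : ∀ {i j} → Adj (C m) i j → colour i j ≡ colour j i
      colour-sym (inj₁ s) = trans (colour-forward s) (sym (colour-backward s))
      colour-sym (inj₂ s) = trans (colour-backward s) (sym (colour-forward s))
      proper : ∀ {i j k} → Adj (C m) i j → Adj (C m) i k → colour i j ≡ colour i k → j ≡ k
      proper (inj₁ s) (inj₁ s') _ = CycSucc-functional s s'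
      proper (inj₂ s) (inj₂ s') _ = CycSucc-injective s s'
      proper (inj₁ s) (inj₂ s') eq =
        ⊥-elim (forward-differs s' (trans (sym (colour-backward s')) (trans (sym eq) (colour-forward s))))
      proper (inj₂ s) (inj₁ s') eq =
        ⊥-elim (forward-differs s (trans (sym (colour-backward s)) (trans eq (colour-forward s'))))

-- Iterated products of cycles

iterC-induction : (op : Graph → Graph → Graph) (P : Graph → ℕ → Set) (step : ℕ → ℕ → ℕ) →
  (∀ {G c m} → 3 ≤ m → P G c → P (op G (C m)) (step c m)) →
  ∀ {G c} ms → All (3 ≤_) ms → P G c → P (foldl (λ G m → op G (C m)) G ms) (foldl step c ms)
iterC-induction op P step next [] [] p = p
iterC-induction op P step next (m ∷ ms) (3≤m ∷ 3≤ms) p = iterC-induction op P step next ms 3≤ms (next 3≤m p)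

ColouredGraph : Graph → ℕ → Set
ColouredGraph G t = FiniteSimpleGraph G × ProperEdgeColouring (Adj G) t

HasVertexOfDegree : Graph → ℕ → Set
HasVertexOfDegree G d = FiniteSimpleGraph G × Σ (V G) λ x → DistinctNeighbours (Adj G) x d

coloured⇒la≤ : ∀ {k t n} {G : Graph} → 1 ≤ k → ColouredGraph G t → t ≤ n → la≤ k G n
coloured⇒la≤ 1≤k (F , χ) t≤n = _ , t≤n , colouring⇒LinDecomp F χ 1≤k

degree⇒la≥ : ∀ {k d} {G : Graph} → HasVertexOfDegree G d → ∀ t → LinDecomp k G t → d ≤ 2 * t
degree⇒la≥ (_ , _ , N) t D = degree≤2*forests D N

cycle-coloured : ∀ {m} → 3 ≤ m → ColouredGraph (C m) 3
cycle-coloured (s≤s (s≤s (s≤s _))) = Cycle.finite _ , Cycle.colouring _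

cycle-degree : ∀ {m} → 3 ≤ m → HasVertexOfDegree (C m) 2
cycle-degree (s≤s (s≤s (s≤s _))) = Cycle.finite _ , 0F , Cycle.neighbours _ 0F

cycle-min-degree : ∀ {m} → 3 ≤ m → MinDegree2 (C m)
cycle-min-degree (s≤s (s≤s (s≤s _))) = 0F , Cycle.neighbours _

□-min-degree : ∀ {G m} → 3 ≤ m → MinDegree2 G → MinDegree2 (G □ C m)
□-min-degree (s≤s (s≤s (s≤s _))) (x , _) =
  (x , 0F) , λ (u , v) → neighbours-mono inj₁ (layerʳ-neighbours u (Cycle.neighbours _ v))

□-coloured : ∀ {G t m} → 3 ≤ m → ColouredGraph G t → ColouredGraph (G □ C m) (3 + t)
□-coloured (s≤s (s≤s (s≤s _))) (F , χ) = □-finite , □-colouring χ (Cycle.colouring _)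
  where open Products F (Cycle.finite _)

∘ₗ-coloured : ∀ {G t m} → 3 ≤ m → ColouredGraph G t → ColouredGraph (G ∘ₗ C m) (t * m + 3)
∘ₗ-coloured (s≤s (s≤s (s≤s _))) (F , χ) = ∘ₗ-finite , ∘ₗ-colouring χ (Cycle.colouring _)
  where open Products F (Cycle.finite _)

∘ₗ-degree : ∀ {G d m} → 3 ≤ m → HasVertexOfDegree G d → HasVertexOfDegree (G ∘ₗ C m) (d * m + 2)
∘ₗ-degree (s≤s (s≤s (s≤s _))) (F , x , N) = ∘ₗ-finite , (x , 0F) , ∘ₗ-neighbours N (Cycle.neighbours _ 0F)
  where open Products F (Cycle.finite _)

×ᵍ-coloured : ∀ {G t m} → 3 ≤ m → ColouredGraph G t → ColouredGraph (G ×ᵍ C m) (t * 3)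
×ᵍ-coloured (s≤s (s≤s (s≤s _))) (F , χ) = ×ᵍ-finite , both-colouring χ (Cycle.colouring _)
  where open Products F (Cycle.finite _)

×ᵍ-degree : ∀ {G d m} → 3 ≤ m → HasVertexOfDegree G d → HasVertexOfDegree (G ×ᵍ C m) (d * 2)
×ᵍ-degree (s≤s (s≤s (s≤s _))) (F , x , N) = ×ᵍ-finite , (x , 0F) , both-neighbours N (Cycle.neighbours _ 0F)
  where open Products F (Cycle.finite _)

⊠-coloured : ∀ {G t m} → 3 ≤ m → ColouredGraph G t → ColouredGraph (G ⊠ C m) ((3 + t) + t * 3)
⊠-coloured (s≤s (s≤s (s≤s _))) (F , χ) = ⊠-finite , ⊠-colouring χ (Cycle.colouring _)
  where open Products F (Cycle.finite _)

⊠-degree : ∀ {G d m} → 3 ≤ m → HasVertexOfDegree G d → HasVertexOfDegree (G ⊠ C m) ((2 + d) + d * 2)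
⊠-degree (s≤s (s≤s (s≤s _))) (F , x , N) = ⊠-finite , (x , 0F) , ⊠-neighbours N (Cycle.neighbours _ 0F)
  where open Products F (Cycle.finite _)

foldl-+ : ∀ c a (ms : List ℕ) → foldl (λ n _ → c + n) a ms ≡ a + length ms * c
foldl-+ c a [] = sym (+-identityʳ a)
foldl-+ c a (_ ∷ ms) = begin
  foldl (λ n _ → c + n) (c + a) ms ≡⟨ foldl-+ c (c + a) ms ⟩
  c + a + length ms * c            ≡⟨ cong (_+ length ms * c) (+-comm c a) ⟩
  a + c + length ms * c            ≡⟨ +-assoc a c (length ms * c) ⟩
  a + (c + length ms * c)          ∎
  where open ≡-Reasoning

foldl-* : ∀ c a (ms : List ℕ) → foldl (λ n _ → n * c) a ms ≡ a * c ^ length ms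
foldl-* c a [] = sym (*-identityʳ a)
foldl-* c a (_ ∷ ms) = trans (foldl-* c (a * c) ms) (*-assoc a c (c ^ length ms))

-- Stated with c * product ms added on both sides, so that no subtraction occurs.
foldl-affine : ∀ c a ms →
  foldl (λ n m → n * m + c) a ms + c * product ms ≡ a * product ms + c * (sufProdSum ms + 1)
foldl-affine c a [] = solve 2 (λ a c → a :+ c :* con 1 := a :* con 1 :+ c :* (con 0 :+ con 1)) refl a c
foldl-affine c a (m ∷ ms) = +-cancelʳ-≡ (c * P) _ _ (begin
  F + c * (m * P) + c * P                      ≡⟨ solve 4 (λ F c m P →
                                                     F :+ c :* (m :* P) :+ c :* P
                                                  := (F :+ c :* P) :+ c :* (m :* P)) refl F c m P ⟩
  (F + c * P) + c * (m * P)                    ≡⟨ cong (_+ c * (m * P)) (foldl-affine c (a * m + c) ms) ⟩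
  (a * m + c) * P + c * (S + 1) + c * (m * P)  ≡⟨ solve 5 (λ a c m P S →
                                                     (a :* m :+ c) :* P :+ c :* (S :+ con 1) :+ c :* (m :* P)
                                                  := a :* (m :* P) :+ c :* ((m :* P :+ S) :+ con 1) :+ c :* P)
                                                  refl a c m P S ⟩
  a * (m * P) + c * ((m * P + S) + 1) + c * P  ∎)
  where
    open ≡-Reasoning
    P S F : ℕ
    P = product ms
    S = sufProdSum ms
    F = foldl (λ n m → n * m + c) (a * m + c) ms

foldl-affine-self : ∀ c ms → foldl (λ n m → n * m + c) c ms ≡ c * (sufProdSum ms + 1)
foldl-affine-self c ms = +-cancelˡ-≡ (c * product ms) _ _
  (trans (+-comm (c * product ms) _) (foldl-affine c c ms))

foldl-strong-degree : ∀ a (ms : List ℕ) → foldl (λ d _ → (2 + d) + d * 2) a ms + 1 ≡ (a + 1) * 3 ^ length ms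
foldl-strong-degree a [] = sym (*-identityʳ (a + 1))
foldl-strong-degree a (_ ∷ ms) = trans (foldl-strong-degree ((2 + a) + a * 2) ms)
  (solve 2 (λ a X → ((con 2 :+ a) :+ a :* con 2 :+ con 1) :* X := (a :+ con 1) :* (con 3 :* X))
     refl a (3 ^ length ms))

strong-colours-step : ∀ {t X} → t ≤ 3 * X → 1 ≤ X → (3 + t) + t * 3 ≤ 3 * (6 * X)
strong-colours-step {t} {X} t≤3X 1≤X = begin
  (3 + t) + t * 3                          ≤⟨ +-mono-≤ (+-mono-≤ (*-monoʳ-≤ 3 1≤X) t≤3X) (*-monoˡ-≤ 3 t≤3X) ⟩
  (3 * X + 3 * X) + 3 * X * 3              ≤⟨ m≤m+n _ (3 * X) ⟩
  (3 * X + 3 * X) + 3 * X * 3 + 3 * X      ≡⟨ solve 1 (λ X → con 3 :* X :+ con 3 :* X :+ con 3 :* X :* con 3 :+ con 3 :* X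
                                                           := con 3 :* (con 6 :* X)) refl X ⟩
  3 * (6 * X)                              ∎
  where open ≤-Reasoning

foldl-strong-colours : ∀ {t} k (ms : List ℕ) → t ≤ 3 * 6 ^ k →
  foldl (λ t _ → (3 + t) + t * 3) t ms ≤ 3 * 6 ^ (k + length ms)
foldl-strong-colours k [] t≤ = subst (λ e → _ ≤ 3 * 6 ^ e) (sym (+-identityʳ k)) t≤
foldl-strong-colours {t} k (_ ∷ ms) t≤ =
  subst (λ e → foldl (λ t _ → (3 + t) + t * 3) ((3 + t) + t * 3) ms ≤ 3 * 6 ^ e) (sym (+-suc k (length ms)))
  (foldl-strong-colours (suc k) ms (strong-colours-step t≤ (m^n>0 6 k)))

□-bounds : ∀ {k} m₁ ms → 3 ≤ m₁ → All (3 ≤_) ms → 1 ≤ k →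
  laBetween k (iterC _□_ m₁ ms) 2 (3 * suc (length ms))
□-bounds m₁ ms 3≤m₁ 3≤ms 1≤k =
    la≥2 min-degree
  , coloured⇒la≤ 1≤k coloured (≤-reflexive (begin
      foldl (λ t _ → 3 + t) 3 ms ≡⟨ foldl-+ 3 3 ms ⟩
      3 + length ms * 3          ≡⟨ cong (3 +_) (*-comm (length ms) 3) ⟩
      3 + 3 * length ms          ≡⟨ *-suc 3 (length ms) ⟨
      3 * suc (length ms)        ∎))
  where
    open ≡-Reasoning
    min-degree : MinDegree2 (iterC _□_ m₁ ms)
    min-degree = iterC-induction _□_ (λ G _ → MinDegree2 G) (λ c _ → c) □-min-degree {c = 0} ms 3≤ms
                   (cycle-min-degree 3≤m₁)
    coloured : ColouredGraph (iterC _□_ m₁ ms) (foldl (λ t _ → 3 + t) 3 ms)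
    coloured = iterC-induction _□_ ColouredGraph (λ t _ → 3 + t) □-coloured ms 3≤ms (cycle-coloured 3≤m₁)

∘ₗ-bounds : ∀ {k} m₁ ms → 3 ≤ m₁ → All (3 ≤_) ms → 1 ≤ k →
  laBetween k (iterC _∘ₗ_ m₁ ms) (1 + sufProdSum ms) (3 * (sufProdSum ms + 1))
∘ₗ-bounds m₁ ms 3≤m₁ 3≤ms 1≤k =
    (λ t D → subst (_≤ t) (+-comm (sufProdSum ms) 1)
      (*-cancelˡ-≤ 2 (subst (_≤ 2 * t) (foldl-affine-self 2 ms) (degree⇒la≥ degree t D))))
  , coloured⇒la≤ 1≤k coloured (≤-reflexive (foldl-affine-self 3 ms))
  where
    degree : HasVertexOfDegree (iterC _∘ₗ_ m₁ ms) (foldl (λ d m → d * m + 2) 2 ms)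
    degree = iterC-induction _∘ₗ_ HasVertexOfDegree (λ d m → d * m + 2) ∘ₗ-degree ms 3≤ms (cycle-degree 3≤m₁)
    coloured : ColouredGraph (iterC _∘ₗ_ m₁ ms) (foldl (λ t m → t * m + 3) 3 ms)
    coloured = iterC-induction _∘ₗ_ ColouredGraph (λ t m → t * m + 3) ∘ₗ-coloured ms 3≤ms (cycle-coloured 3≤m₁)

×ᵍ-bounds : ∀ {k} m₁ ms → 3 ≤ m₁ → All (3 ≤_) ms → 1 ≤ k →
  laBetween k (iterC _×ᵍ_ m₁ ms) (2 ^ length ms) (3 * 6 ^ length ms)
×ᵍ-bounds m₁ ms 3≤m₁ 3≤ms 1≤k =
    (λ t D → *-cancelˡ-≤ 2 (subst (_≤ 2 * t) (foldl-* 2 2 ms) (degree⇒la≥ degree t D)))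
  , coloured⇒la≤ 1≤k coloured
      (≤-trans (≤-reflexive (foldl-* 3 3 ms)) (*-monoʳ-≤ 3 (^-monoˡ-≤ (length ms) (s≤s (s≤s (s≤s z≤n))))))
  where
    degree : HasVertexOfDegree (iterC _×ᵍ_ m₁ ms) (foldl (λ d _ → d * 2) 2 ms)
    degree = iterC-induction _×ᵍ_ HasVertexOfDegree (λ d _ → d * 2) ×ᵍ-degree ms 3≤ms (cycle-degree 3≤m₁)
    coloured : ColouredGraph (iterC _×ᵍ_ m₁ ms) (foldl (λ t _ → t * 3) 3 ms)
    coloured = iterC-induction _×ᵍ_ ColouredGraph (λ t _ → t * 3) ×ᵍ-coloured ms 3≤ms (cycle-coloured 3≤m₁)

⊠-bounds : ∀ {k} m₁ ms → 3 ≤ m₁ → All (3 ≤_) ms → 1 ≤ k →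
  laBetween k (iterC _⊠_ m₁ ms) ((3 ^ suc (length ms) ∸ 1) / 2) (3 * (suc (length ms) + 6 ^ length ms))
⊠-bounds m₁ ms 3≤m₁ 3≤ms 1≤k =
    (λ t D → begin
      (3 ^ suc (length ms) ∸ 1) / 2 ≡⟨ cong (λ n → n / 2) 3^r∸1≡d ⟩
      d / 2                         ≤⟨ /-monoˡ-≤ 2 (degree⇒la≥ degree t D) ⟩
      2 * t / 2                     ≡⟨ cong (_/ 2) (*-comm 2 t) ⟩
      t * 2 / 2                     ≡⟨ m*n/n≡m t 2 ⟩
      t                             ∎)
  , coloured⇒la≤ 1≤k coloured
      (≤-trans (foldl-strong-colours 0 ms ≤-refl) (*-monoʳ-≤ 3 (m≤n+m (6 ^ length ms) (suc (length ms)))))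
  where
    open ≤-Reasoning
    d : ℕ
    d = foldl (λ d _ → (2 + d) + d * 2) 2 ms
    degree : HasVertexOfDegree (iterC _⊠_ m₁ ms) d
    degree = iterC-induction _⊠_ HasVertexOfDegree (λ d _ → (2 + d) + d * 2) ⊠-degree ms 3≤ms (cycle-degree 3≤m₁)
    coloured : ColouredGraph (iterC _⊠_ m₁ ms) (foldl (λ t _ → (3 + t) + t * 3) 3 ms)
    coloured = iterC-induction _⊠_ ColouredGraph (λ t _ → (3 + t) + t * 3) ⊠-coloured ms 3≤ms (cycle-coloured 3≤m₁)
    3^r∸1≡d : 3 ^ suc (length ms) ∸ 1 ≡ d
    3^r∸1≡d = trans (cong (_∸ 1) (sym (foldl-strong-degree 2 ms))) (m+n∸n≡m d 1)

proposition3p4 :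
    (m₁ : ℕ) (ms : List ℕ) (k : ℕ) →
    3 ≤ m₁ → All (λ m → 3 ≤ m) ms → 1 ≤ k →
    let r = suc (length ms) in
      laBetween k (iterC _□_ m₁ ms) 2 (3 * r)
    × laBetween k (iterC _∘ₗ_ m₁ ms) (1 + sufProdSum ms) (3 * (sufProdSum ms + 1))
    × laBetween k (iterC _×ᵍ_ m₁ ms) (2 ^ (r ∸ 1)) (3 * 6 ^ (r ∸ 1))
    × laBetween k (iterC _⊠_ m₁ ms) ((3 ^ r ∸ 1) / 2) (3 * (r + 6 ^ (r ∸ 1)))
proposition3p4 m₁ ms k 3≤m₁ 3≤ms 1≤k =
  □-bounds m₁ ms 3≤m₁ 3≤ms 1≤k , ∘ₗ-bounds m₁ ms 3≤m₁ 3≤ms 1≤k ,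
  ×ᵍ-bounds m₁ ms 3≤m₁ 3≤ms 1≤k , ⊠-bounds m₁ ms 3≤m₁ 3≤ms 1≤k
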